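{- For every integer $r \ge 4$, let $M_{2^r} = \langle x,y \mid x^2 = y^{2^{r-1}} = 1,\ x^{ -1}yx = y^{2^{r-2}+1}\rangle$. Then $$D'(M_{2^r}) = D(M_{2^r}) = 2^{r-1}+1.$$
   Context: For a finite group $G$: $D(G)$ is the least positive integer $k$ such that every sequence $g_1\cdots g_k$ of $k$ elements of $G$ (repetitions allowed) has indices $1\le i_1<\cdots<i_m\le k$, $m\ge1$, with $g_{i_1}\cdots g_{i_m}=1$ (product in increasing index order). $D'(G)$ is the least positive integer $k$ such that every sequence $g_1\cdots g_k$ of $k$ elements of $G$ has a nonempty subsequence $g_{i_1},\dots,g_{i_m}$ with $g_{i_{\tau(1)}}\cdots g_{i_{\tau(m)}} = 1$ for some permutation $\tau$ of $\{1,\dots,m\}$. -}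

module Defs where

open import Level using (Level)
open import Data.Nat using (ℕ; zero; suc; _+_; _*_; _∸_; _^_; _≤_; NonZero)
open import Data.Nat.Properties using (m^n≢0)
open import Data.Nat.DivMod using (_mod_)
open import Data.Fin using (Fin; toℕ) renaming (_<_ to _<ᶠ_)
open import Data.Fin.Permutation using (Permutation′; _⟨$⟩ʳ_)
open import Data.Product using (_×_; _,_; Σ; ∃-syntax)
open import Data.Vec.Functional using (foldr)
open import Function using (_∘_)
open import Relation.Binary.PropositionalEquality using (_≡_; refl)
open import Algebra.Bundles.Raw using (RawMonoid)

IsLeastPos : ∀ {p} → (ℕ → Set p) → ℕ → Set p
IsLeastPos P n = 1 ≤ n × P n × (∀ k → 1 ≤ k → P k → n ≤ k)

module _ {c ℓ : Level} (G : RawMonoid c ℓ) where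
  open RawMonoid G

  prod : ∀ {m} → (Fin m → Carrier) → Carrier
  prod g = foldr _∙_ ε g

  StrictlyIncreasing : ∀ {m k} → (Fin m → Fin k) → Set
  StrictlyIncreasing i = ∀ a b → a <ᶠ b → i a <ᶠ i b

  DProp : ℕ → Set _
  DProp k = (g : Fin k → Carrier) →
    ∃[ m ] Σ (Fin (suc m) → Fin k) λ i →
      StrictlyIncreasing i × (prod (g ∘ i) ≈ ε)

  D'Prop : ℕ → Set _
  D'Prop k = (g : Fin k → Carrier) →
    ∃[ m ] Σ (Fin (suc m) → Fin k) λ i → Σ (Permutation′ (suc m)) λ τ →
      StrictlyIncreasing i × (prod (λ j → g (i (τ ⟨$⟩ʳ j))) ≈ ε)

  DavenportIs : ℕ → Set _
  DavenportIs n = IsLeastPos DProp n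

  StrongDavenportIs : ℕ → Set _
  StrongDavenportIs n = IsLeastPos D'Prop n

-- The modular group M_{2^r} = ⟨x,y | x² = y^{2^{r-1}} = 1, x⁻¹yx = y^{2^{r-2}+1}⟩,
-- realised concretely: (a , b) stands for x^a y^b, a ∈ Z/2, b ∈ Z/2^{r-1}.
-- Using y^b x^c = x^c y^{b(1+2^{r-2})^c}:
--   (x^a y^b)(x^c y^d) = x^{a+c} y^{b(1+2^{r-2})^c + d}.
Mcarrier : ℕ → Set
Mcarrier r = Fin 2 × Fin (2 ^ (r ∸ 1))

Mmul : (r : ℕ) → Mcarrier r → Mcarrier r → Mcarrier r
Mmul r (a , b) (c , d) =
  ((toℕ a + toℕ c) mod 2 ,
   _mod_ (toℕ b * (1 + 2 ^ (r ∸ 2)) ^ toℕ c + toℕ d) (2 ^ (r ∸ 1)) {{m^n≢0 2 (r ∸ 1)}})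

Mone : (r : ℕ) → Mcarrier r
Mone r = (0 mod 2 , _mod_ 0 (2 ^ (r ∸ 1)) {{m^n≢0 2 (r ∸ 1)}})

M : ℕ → RawMonoid _ _
M r = record { Carrier = Mcarrier r ; _≈_ = _≡_ ; _∙_ = Mmul r ; ε = Mone r }

module Submission where

-- Lower bound: put N = 2^(r-1). In x y^(N-1) every nonempty subsequence, multiplied in any order,
-- either contains x exactly once, and then has odd x-exponent, or is a power y^m with 0 < m < N.
--
-- Upper bound: the exponents of x and y modulo 2 give a homomorphism τ onto the Klein four-group V,
-- with kernel of size N/2. Read a sequence from the right: prepending g to a suffix whose set A of
-- subproducts contains ε but not g⁻¹ replaces A by A ∪ gA. Let aᵥ be the number of elements of A
-- in the fibre τ⁻¹(v). After 2s elements a₀ ≥ s, and a₀ > s unless every aᵥ ≥ s; after 2s+1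
-- elements a₀ ≥ s+1, and a₀ > s+1 unless some aᵥ > s with v ≠ 0. Comparing the fibres of A and
-- A ∪ gA proves this, except when all aᵥ = s and only a₀ grows. That case is excluded by a
-- cyclic-subgroup argument: if ε ∈ X, g⁻¹ ∉ X and |X ∪ gX| = |X| + 1, then X ∪ ⟨g⟩ is closed
-- under multiplication by g, so |⟨g⟩| does not divide |X|; but it divides |Y| whenever gY ⊆ Y.
-- Take for X and Y the parts of A over two cosets of an order-2 subgroup of V containing τ g,
-- the first containing 0 and the second not: both have 2s elements, X grows by one, Y does not.
-- Hence N+1 elements without a zero subproduct would put more than N/2 elements into the kernel.

open import Defs
open import Data.Nat using (ℕ; _+_; _∸_; _^_; _≤_)
open import Data.Product using (_×_)

open import Algebra.Bundles using (Group; CommutativeRing; RawMonoid)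
import Algebra.Definitions.RawMonoid as RawMonoidDefinitions
import Algebra.Properties.CommutativeMonoid.Sum
import Algebra.Properties.Group as GroupProperties
import Algebra.Properties.Monoid as MonoidProperties
import Algebra.Properties.Monoid.Mult as MonoidMult
import Algebra.Properties.Monoid.Sum as MonoidSum
open import Algebra.Structures using (IsGroup)
open import Data.Bool using (Bool; true; false; not; _∧_; _∨_; _xor_; if_then_else_)
import Data.Bool as Bool
open import Data.Bool.Properties
  using (xor-∧-commutativeRing; ∧-zeroʳ; ∧-identityʳ; ∨-zeroʳ; ∧-distribʳ-∨; not-distribˡ-xor; xor-identityʳ)
open import Data.Empty using (⊥; ⊥-elim)
open import Data.Fin using (Fin; zero; suc; toℕ)
import Data.Fin as Fin
open import Data.Fin.Permutation using (Permutation′; _⟨$⟩ʳ_)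
import Data.Fin.Permutation as Perm
import Data.Fin.Properties as Finₚ
open import Data.Nat
  using (zero; suc; _*_; _<_; z≤n; s≤s; s≤s⁻¹; z<s; NonZero; >-nonZero; >-nonZero⁻¹; _%_; _/_)
open import Data.Nat.DivMod
  using (_mod_; m≡m%n+[m/n]*n; [m+kn]%n≡m%n; %-distribˡ-+; m%n%n≡m%n; m<n⇒m%n≡m; m*n%n≡0; n%n≡0)
open import Data.Nat.Divisibility using (_∣_; _∣0; ∣-refl; ∣m∣n⇒∣m+n; ∣m+n∣m⇒∣n; ∣⇒≤)
open import Data.Nat.Properties hiding (_≟_)
open import Data.Nat.Properties using () renaming (_≟_ to _≟ℕ_)
open import Algebra.Properties.CommutativeSemigroup +-commutativeSemigroup using (interchange)
import Algebra.Properties.CommutativeMonoid.Sum +-0-commutativeMonoid as ℕSum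
open import Data.Nat.Tactic.RingSolver using (solve-∀)
open import Data.Product using (Σ; ∃; ∃-syntax; _,_; proj₁; proj₂)
open import Data.Product.Properties using (≡-dec)
open import Data.Sum using (_⊎_; inj₁; inj₂)
open import Data.Vec.Functional using (head; tail; _∷_)
open import Function using (_∘_; _↔_; Inverse; mk↔ₛ′)
open import Function.Properties.Inverse using (↔-sym; ↔-trans)
open import Level using (0ℓ)
open import Relation.Binary.Definitions using (tri<; tri≈; tri>)
open import Relation.Binary.PropositionalEquality hiding ([_])
open import Relation.Nullary using (¬_; Dec; yes; no; does; proof; contradiction)
open import Relation.Nullary.Decidable
  using (map′; dec-true; dec-false; toWitness; ¬?; _×-dec_; _⊎-dec_; _→-dec_)
open import Relation.Nullary.Reflects using (Reflects; invert)

boundary : (f : ℕ → Bool) → f 0 ≡ true → ∀ m → f m ≡ false → ∃[ i ] (f i ≡ true × f (suc i) ≡ false)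
boundary f f₀ zero f₀′ with () ← trans (sym f₀) f₀′
boundary f f₀ (suc m) fₘ₊₁ with f m in fₘ
... | true = m , fₘ , fₘ₊₁
... | false = boundary f f₀ m fₘ

D⇒D′ : ∀ {c ℓ} (G : RawMonoid c ℓ) {k} → DProp G k → D'Prop G k
D⇒D′ G D g = let m , i , increasing , Π≈ε = D g in m , i , Perm.id , increasing , Π≈ε

least-positive : ∀ {p} {P : ℕ → Set p} {n} → 1 ≤ n → P n → (∀ k → 1 ≤ k → k < n → ¬ P k) →
  IsLeastPos P n
least-positive 1≤n Pn below = 1≤n , Pn , λ k 1≤k Pk → ≮⇒≥ λ k<n → below k 1≤k k<n Pk

-- Counting

indicator : Bool → ℕ
indicator b = if b then 1 else 0

count : ∀ {n} → (Fin n → Bool) → ℕ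
count p = ℕSum.sum (indicator ∘ p)

count-cong : ∀ {n} {p q : Fin n → Bool} → (∀ i → p i ≡ q i) → count p ≡ count q
count-cong p≗q = ℕSum.sum-cong-≗ (cong indicator ∘ p≗q)

count-permute : ∀ {n} (p : Fin n → Bool) (π : Permutation′ n) → count p ≡ count (p ∘ (π ⟨$⟩ʳ_))
count-permute p π = ℕSum.sum-permute (indicator ∘ p) π

count-mono : ∀ {n} {p q : Fin n → Bool} → (∀ i → p i ≡ true → q i ≡ true) → count p ≤ count q
count-mono {zero} p⊆q = z≤n
count-mono {suc n} {p} {q} p⊆q = +-mono-≤ (indicator-mono (p⊆q zero)) (count-mono (p⊆q ∘ suc))
  where
  indicator-mono : ∀ {a b} → (a ≡ true → b ≡ true) → indicator a ≤ indicator b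
  indicator-mono {false} _ = z≤n
  indicator-mono {true} a⇒b rewrite a⇒b refl = ≤-refl

count-split : ∀ {n} (p q : Fin n → Bool) →
  count p ≡ count (λ i → p i ∧ q i) + count (λ i → p i ∧ not (q i))
count-split {zero} p q = refl
count-split {suc n} p q =
  trans (cong₂ _+_ (indicator-split (p zero) (q zero)) (count-split (p ∘ suc) (q ∘ suc)))
        (interchange (indicator (p zero ∧ q zero)) (indicator (p zero ∧ not (q zero)))
                     (count (λ i → p (suc i) ∧ q (suc i))) (count (λ i → p (suc i) ∧ not (q (suc i)))))
  where
  indicator-split : ∀ a b → indicator a ≡ indicator (a ∧ b) + indicator (a ∧ not b)
  indicator-split false b = refl
  indicator-split true false = refl
  indicator-split true true = refl

count-pos : ∀ {n} (p : Fin n → Bool) i → p i ≡ true → 0 < count p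
count-pos p zero pᵢ rewrite pᵢ = s≤s z≤n
count-pos p (suc i) pᵢ = ≤-trans (count-pos (p ∘ suc) i pᵢ) (m≤n+m _ (indicator (p zero)))

count-witness : ∀ {n} (p : Fin n → Bool) → 0 < count p → ∃ λ i → p i ≡ true
count-witness {suc n} p count>0 with p zero in p₀
... | true = zero , p₀
... | false = let i , pᵢ = count-witness (p ∘ suc) count>0 in suc i , pᵢ

count-all : ∀ n → count {n} (λ _ → true) ≡ n
count-all zero = refl
count-all (suc n) = cong suc (count-all n)

Subset : Set → Set
Subset X = X → Bool

module _ {X : Set} where

  infix 4 _∈_ _∉_ _⊆_
  infixr 7 _∩_ _∖_
  infixr 6 _∪_

  _∈_ _∉_ : X → Subset X → Set
  x ∈ A = A x ≡ true
  x ∉ A = A x ≡ false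

  _∪_ _∩_ _∖_ : Subset X → Subset X → Subset X
  (A ∪ B) x = A x ∨ B x
  (A ∩ B) x = A x ∧ B x
  (A ∖ B) x = A x ∧ not (B x)

  full : Subset X
  full _ = true

  _⊆_ : Subset X → Subset X → Set
  A ⊆ B = ∀ x → x ∈ A → x ∈ B

  module _ {A B : Subset X} {x : X} where

    ∪-introˡ : x ∈ A → x ∈ A ∪ B
    ∪-introˡ x∈A rewrite x∈A = refl

    ∪-introʳ : x ∈ B → x ∈ A ∪ B
    ∪-introʳ x∈B rewrite x∈B = ∨-zeroʳ (A x)

    ∪-elim : x ∈ A ∪ B → x ∈ A ⊎ x ∈ B
    ∪-elim x∈A∪B with A x
    ... | true = inj₁ refl
    ... | false = inj₂ x∈A∪B

    ∩-intro : x ∈ A → x ∈ B → x ∈ A ∩ B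
    ∩-intro x∈A x∈B rewrite x∈A | x∈B = refl

    ∖-intro : x ∈ A → x ∉ B → x ∈ A ∖ B
    ∖-intro x∈A x∉B rewrite x∈A | x∉B = refl

    ∖-elim : x ∈ A ∖ B → x ∈ A × x ∉ B
    ∖-elim x∈A∖B with A x | B x
    ... | true | false = refl , refl

  ⊆-∪ˡ : (A B : Subset X) → A ⊆ A ∪ B
  ⊆-∪ˡ A B x = ∪-introˡ {A = A} {B = B} {x = x}

  ⊆-∪ʳ : (A B : Subset X) → B ⊆ A ∪ B
  ⊆-∪ʳ A B x = ∪-introʳ {A = A} {B = B} {x = x}

  ∩-⊆ʳ : (A B : Subset X) → A ∩ B ⊆ B
  ∩-⊆ʳ A B x x∈A∩B with A x
  ... | true = x∈A∩B

  ∩-monoˡ : {A B : Subset X} (C : Subset X) → A ⊆ B → A ∩ C ⊆ B ∩ C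
  ∩-monoˡ {A} C A⊆B x x∈A∩C with A x in x∈A
  ... | true rewrite A⊆B x x∈A = x∈A∩C

  ⊆⇒∩≗ : {A B : Subset X} → A ⊆ B → ∀ x → (B ∩ A) x ≡ A x
  ⊆⇒∩≗ {A} {B} A⊆B x with A x in eq
  ... | true rewrite A⊆B x eq = refl
  ... | false = ∧-zeroʳ (B x)

  ∪∩≗ : (A B : Subset X) → ∀ x → ((A ∪ B) ∩ A) x ≡ A x
  ∪∩≗ A B = ⊆⇒∩≗ (⊆-∪ˡ A B)

  ∪∖≗ : (A B : Subset X) → ∀ x → ((A ∪ B) ∖ A) x ≡ (B ∖ A) x
  ∪∖≗ A B x with A x
  ... | true = sym (∧-zeroʳ (B x))
  ... | false = refl

-- Finite groups

record FiniteGroup : Set₁ where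
  infixl 7 _∙_
  infix 8 _⁻¹
  field
    Carrier : Set
    _∙_ : Carrier → Carrier → Carrier
    ε : Carrier
    _⁻¹ : Carrier → Carrier
    isGroup : IsGroup _≡_ _∙_ ε _⁻¹
    size : ℕ
    enumeration : Carrier ↔ Fin size

  group : Group 0ℓ 0ℓ
  group = record { Carrier = Carrier ; _≈_ = _≡_ ; _∙_ = _∙_ ; ε = ε ; _⁻¹ = _⁻¹ ; isGroup = isGroup }

  open Group group public using (rawMonoid; monoid; assoc; identityˡ; identityʳ; inverseˡ; inverseʳ)

module FiniteGroupTheory (G : FiniteGroup) where

  open FiniteGroup G
  open Inverse enumeration using (to; from; strictlyInverseʳ)
  open MonoidProperties monoid using (cancelˡ; cancelʳ)
  open GroupProperties group using (identityˡ-unique; inverseʳ-unique)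
  open RawMonoidDefinitions rawMonoid using () renaming (_×_ to power)
  open MonoidMult monoid using () renaming (×-homo-+ to power-+)

  to-injective : ∀ {x y} → to x ≡ to y → x ≡ y
  to-injective {x} {y} eq = trans (sym (strictlyInverseʳ x)) (trans (cong from eq) (strictlyInverseʳ y))

  infix 4 _≟_
  _≟_ : (x y : Carrier) → Dec (x ≡ y)
  x ≟ y = map′ to-injective (cong to) (to x Fin.≟ to y)

  ｛_｝ : Carrier → Subset Carrier
  ｛ a ｝ x = does (x ≟ a)

  ∈｛｝⇒≡ : ∀ {a x} → x ∈ ｛ a ｝ → x ≡ a
  ∈｛｝⇒≡ {a} {x} x∈｛a｝ = invert (subst (Reflects (x ≡ a)) x∈｛a｝ (proof (x ≟ a)))

  ∣_∣ : Subset Carrier → ℕ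
  ∣ A ∣ = count (A ∘ from)

  ∣∣-cong : {A B : Subset Carrier} → (∀ x → A x ≡ B x) → ∣ A ∣ ≡ ∣ B ∣
  ∣∣-cong A≗B = count-cong (A≗B ∘ from)

  ∣∣-mono : {A B : Subset Carrier} → A ⊆ B → ∣ A ∣ ≤ ∣ B ∣
  ∣∣-mono A⊆B = count-mono (A⊆B ∘ from)

  ∣∣-split : (A B : Subset Carrier) → ∣ A ∣ ≡ ∣ A ∩ B ∣ + ∣ A ∖ B ∣
  ∣∣-split A B = count-split (A ∘ from) (B ∘ from)

  ∣∣-pos : (A : Subset Carrier) {a : Carrier} → a ∈ A → 0 < ∣ A ∣
  ∣∣-pos A {a} a∈A = count-pos (A ∘ from) (to a) (trans (cong A (strictlyInverseʳ a)) a∈A)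

  ∣∣-bijection : (A : Subset Carrier) (φ : Carrier ↔ Carrier) → ∣ A ∘ Inverse.to φ ∣ ≡ ∣ A ∣
  ∣∣-bijection A φ = sym (trans (count-permute (A ∘ from) π)
                                (count-cong (cong A ∘ strictlyInverseʳ ∘ Inverse.to φ ∘ from)))
    where
    π : Permutation′ size
    π = ↔-trans (↔-sym enumeration) (↔-trans φ enumeration)

  ∣∪∣ : (A B : Subset Carrier) → ∣ A ∪ B ∣ ≡ ∣ A ∣ + ∣ B ∖ A ∣
  ∣∪∣ A B = trans (∣∣-split (A ∪ B) A) (cong₂ _+_ (∣∣-cong (∪∩≗ A B)) (∣∣-cong (∪∖≗ A B)))

  ∣∣-strict : {A B : Subset Carrier} {a : Carrier} → A ⊆ B → a ∉ A → a ∈ B → suc ∣ A ∣ ≤ ∣ B ∣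
  ∣∣-strict {A} {B} A⊆B a∉A a∈B = begin
    suc ∣ A ∣              ≡⟨ +-comm 1 ∣ A ∣ ⟩
    ∣ A ∣ + 1              ≤⟨ +-monoʳ-≤ ∣ A ∣ (∣∣-pos (B ∖ A) (∖-intro {A = B} {B = A} a∈B a∉A)) ⟩
    ∣ A ∣ + ∣ B ∖ A ∣      ≡⟨ cong (_+ ∣ B ∖ A ∣) (∣∣-cong (⊆⇒∩≗ A⊆B)) ⟨
    ∣ B ∩ A ∣ + ∣ B ∖ A ∣  ≡⟨ ∣∣-split B A ⟨
    ∣ B ∣                  ∎
    where open ≤-Reasoning

  ∣∣≥2 : (A : Subset Carrier) {a b : Carrier} → a ≢ b → a ∈ A → b ∈ A → 2 ≤ ∣ A ∣
  ∣∣≥2 A {a} {b} a≢b a∈A b∈A = begin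
    1 + 1
      ≤⟨ +-mono-≤ (∣∣-pos (A ∩ ｛ a ｝) a∈A∩a) (∣∣-pos (A ∖ ｛ a ｝) b∈A∖a) ⟩
    ∣ A ∩ ｛ a ｝ ∣ + ∣ A ∖ ｛ a ｝ ∣  ≡⟨ ∣∣-split A ｛ a ｝ ⟨
    ∣ A ∣                              ∎
    where
    open ≤-Reasoning
    a∈A∩a : a ∈ A ∩ ｛ a ｝
    a∈A∩a = ∩-intro {A = A} {B = ｛ a ｝} {x = a} a∈A (dec-true (a ≟ a) refl)
    b∈A∖a : b ∈ A ∖ ｛ a ｝
    b∈A∖a = ∖-intro {A = A} {B = ｛ a ｝} {x = b} b∈A (dec-false (b ≟ a) (a≢b ∘ sym))

  ∣∪∣≤⇒⊆ : (A B : Subset Carrier) → ∣ A ∪ B ∣ ≤ ∣ A ∣ → B ⊆ A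
  ∣∪∣≤⇒⊆ A B ∣A∪B∣≤∣A∣ x x∈B with A x in x∈?A
  ... | true = refl
  ... | false = ⊥-elim (1+n≰n (≤-trans (∣∣-strict (⊆-∪ˡ A B) x∈?A (⊆-∪ʳ A B x x∈B))
                                       ∣A∪B∣≤∣A∣))

  ∣∪∣≤suc⇒unique : (A B : Subset Carrier) {a b : Carrier} → ∣ A ∪ B ∣ ≤ suc ∣ A ∣ →
    a ∈ B ∖ A → b ∈ B ∖ A → a ≡ b
  ∣∪∣≤suc⇒unique A B {a} {b} ∣A∪B∣≤ a∈ b∈ with a ≟ b
  ... | yes a≡b = a≡b
  ... | no a≢b = ⊥-elim (1+n≰n (begin
    suc (suc ∣ A ∣)     ≡⟨ +-comm 2 ∣ A ∣ ⟩
    ∣ A ∣ + 2           ≤⟨ +-monoʳ-≤ ∣ A ∣ (∣∣≥2 (B ∖ A) a≢b a∈ b∈) ⟩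
    ∣ A ∣ + ∣ B ∖ A ∣   ≡⟨ ∣∪∣ A B ⟨
    ∣ A ∪ B ∣           ≤⟨ ∣A∪B∣≤ ⟩
    suc ∣ A ∣           ∎))
    where open ≤-Reasoning

  ∣∣-witness : (A : Subset Carrier) → 0 < ∣ A ∣ → ∃ (_∈ A)
  ∣∣-witness A ∣A∣>0 = let i , Aᵢ = count-witness (A ∘ from) ∣A∣>0 in from i , Aᵢ

  infixr 8 _◃_
  infixl 8 _▹_

  _◃_ : Carrier → Subset Carrier → Subset Carrier
  (g ◃ A) x = A (g ⁻¹ ∙ x)

  _▹_ : Subset Carrier → Carrier → Subset Carrier
  (A ▹ g) x = A (x ∙ g ⁻¹)

  ∙-∈-◃ : ∀ {A} g {x} → x ∈ A → g ∙ x ∈ g ◃ A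
  ∙-∈-◃ {A} g {x} x∈A = trans (cong A (cancelˡ (inverseˡ g) x)) x∈A

  ∣◃∣ : ∀ g A → ∣ g ◃ A ∣ ≡ ∣ A ∣
  ∣◃∣ g A = ∣∣-bijection A (mk↔ₛ′ (g ⁻¹ ∙_) (g ∙_) (cancelˡ (inverseˡ g)) (cancelˡ (inverseʳ g)))

  ∣▹∣ : ∀ A g → ∣ A ▹ g ∣ ≡ ∣ A ∣
  ∣▹∣ A g = ∣∣-bijection A (mk↔ₛ′ (_∙ g ⁻¹) (_∙ g) (cancelʳ (inverseʳ g)) (cancelʳ (inverseˡ g)))

  finite-order : ∀ g → ∃[ k ] (0 < k × power k g ≡ ε)
  finite-order g with Finₚ.pigeonhole (n<1+n size) (λ (i : Fin (suc size)) → to (power (toℕ i) g))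
  ... | i , j , i<j , gⁱ≡gʲ = toℕ j ∸ toℕ i , m<n⇒0<n∸m i<j , identityˡ-unique _ _ (begin
    power (toℕ j ∸ toℕ i) g ∙ power (toℕ i) g  ≡⟨ power-+ g (toℕ j ∸ toℕ i) (toℕ i) ⟨
    power (toℕ j ∸ toℕ i + toℕ i) g            ≡⟨ cong (λ m → power m g) (m∸n+n≡m (<⇒≤ i<j)) ⟩
    power (toℕ j) g                            ≡⟨ to-injective gⁱ≡gʲ ⟨
    power (toℕ i) g                            ∎)
    where open ≡-Reasoning

  module Cyclic (g : Carrier) {k : ℕ} (k>0 : 0 < k) (gᵏ≡ε : power k g ≡ ε) where

    ⟨g⟩ : Subset Carrier
    ⟨g⟩ x = does (Finₚ.any? (λ (i : Fin k) → power (toℕ i) g ≟ x))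

    power-<-∈ : ∀ {i} → i < k → power i g ∈ ⟨g⟩
    power-<-∈ i<k = dec-true (Finₚ.any? _) (Fin.fromℕ< i<k , cong (λ m → power m g) (Finₚ.toℕ-fromℕ< i<k))

    ⟨g⟩-elim : ∀ {x} → x ∈ ⟨g⟩ → ∃[ i ] (i < k × power i g ≡ x)
    ⟨g⟩-elim {x} x∈⟨g⟩ with Finₚ.any? (λ (i : Fin k) → power (toℕ i) g ≟ x)
    ... | yes (i , gⁱ≡x) = toℕ i , Finₚ.toℕ<n i , gⁱ≡x
    ⟨g⟩-elim () | no _

    g∙-∈ : ∀ {x} → x ∈ ⟨g⟩ → g ∙ x ∈ ⟨g⟩
    g∙-∈ x∈⟨g⟩ with ⟨g⟩-elim x∈⟨g⟩
    ... | i , i<k , refl with suc i ≟ℕ k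
    ...   | no 1+i≢k = power-<-∈ (≤∧≢⇒< i<k 1+i≢k)
    ...   | yes 1+i≡k = subst (λ m → power m g ∈ ⟨g⟩) (sym 1+i≡k)
                              (subst (_∈ ⟨g⟩) (sym gᵏ≡ε) (power-<-∈ k>0))

    power-∈ : ∀ i → power i g ∈ ⟨g⟩
    power-∈ zero = power-<-∈ k>0
    power-∈ (suc i) = g∙-∈ (power-∈ i)

    g⁻¹≡power : g ⁻¹ ≡ power (k ∸ 1) g
    g⁻¹≡power = sym (inverseʳ-unique g (power (k ∸ 1) g)
                                     (trans (cong (λ m → power m g) (m+[n∸m]≡n k>0)) gᵏ≡ε))

    g⁻¹∙-∈ : ∀ {x} → x ∈ ⟨g⟩ → g ⁻¹ ∙ x ∈ ⟨g⟩
    g⁻¹∙-∈ x∈⟨g⟩ with ⟨g⟩-elim x∈⟨g⟩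
    ... | i , _ , refl = subst (_∈ ⟨g⟩) (trans (power-+ g (k ∸ 1) i) (cong (_∙ power i g) (sym g⁻¹≡power)))
                                        (power-∈ (k ∸ 1 + i))

    LeftClosed : Subset Carrier → Set
    LeftClosed Y = ∀ x → x ∈ Y → g ∙ x ∈ Y

    module _ {Y : Subset Carrier} (closed : LeftClosed Y) {y : Carrier} (y∈Y : y ∈ Y) where

      power∙-∈ : ∀ i → power i g ∙ y ∈ Y
      power∙-∈ zero = subst (_∈ Y) (sym (identityˡ y)) y∈Y
      power∙-∈ (suc i) = subst (_∈ Y) (sym (assoc g (power i g) y)) (closed _ (power∙-∈ i))

      orbit-⊆ : ⟨g⟩ ▹ y ⊆ Y
      orbit-⊆ x x∈⟨g⟩y with ⟨g⟩-elim x∈⟨g⟩y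
      ... | i , _ , gⁱ≡xy⁻¹ =
        subst (_∈ Y) (trans (cong (_∙ y) gⁱ≡xy⁻¹) (cancelʳ (inverseˡ y) x)) (power∙-∈ i)

      ∖orbit-closed : LeftClosed (Y ∖ ⟨g⟩ ▹ y)
      ∖orbit-closed x x∈ with ∖-elim {A = Y} {B = ⟨g⟩ ▹ y} x∈
      ... | x∈Y , x∉⟨g⟩y = ∖-intro {A = Y} {B = ⟨g⟩ ▹ y} (closed x x∈Y) gx∉⟨g⟩y
        where
        g⁻¹gxy⁻¹≡xy⁻¹ : g ⁻¹ ∙ ((g ∙ x) ∙ y ⁻¹) ≡ x ∙ y ⁻¹
        g⁻¹gxy⁻¹≡xy⁻¹ = trans (cong (g ⁻¹ ∙_) (assoc g x (y ⁻¹))) (cancelˡ (inverseˡ g) (x ∙ y ⁻¹))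
        gx∉⟨g⟩y : g ∙ x ∉ ⟨g⟩ ▹ y
        gx∉⟨g⟩y with ⟨g⟩ ((g ∙ x) ∙ y ⁻¹) in gxy⁻¹∈
        ... | false = refl
        ... | true with () ← trans (sym (subst (_∈ ⟨g⟩) g⁻¹gxy⁻¹≡xy⁻¹ (g⁻¹∙-∈ gxy⁻¹∈))) x∉⟨g⟩y

      ∣∣-orbit : ∣ Y ∣ ≡ ∣ ⟨g⟩ ∣ + ∣ Y ∖ ⟨g⟩ ▹ y ∣
      ∣∣-orbit = trans (∣∣-split Y (⟨g⟩ ▹ y))
                       (cong (_+ ∣ Y ∖ ⟨g⟩ ▹ y ∣) (trans (∣∣-cong (⊆⇒∩≗ orbit-⊆)) (∣▹∣ ⟨g⟩ y)))

    ∣⟨g⟩∣>0 : 0 < ∣ ⟨g⟩ ∣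
    ∣⟨g⟩∣>0 = ∣∣-pos ⟨g⟩ (power-∈ 0)

    -- Y is a disjoint union of cosets ⟨g⟩ ▹ y.
    ∣⟨g⟩∣-divides-closed : ∀ Y → LeftClosed Y → ∣ ⟨g⟩ ∣ ∣ ∣ Y ∣
    ∣⟨g⟩∣-divides-closed Y closed = go ∣ Y ∣ Y closed ≤-refl
      where
      go : ∀ c Y → LeftClosed Y → ∣ Y ∣ ≤ c → ∣ ⟨g⟩ ∣ ∣ ∣ Y ∣
      go c Y closed ∣Y∣≤c with ∣ Y ∣ ≟ℕ 0
      ... | yes ∣Y∣≡0 = subst (∣ ⟨g⟩ ∣ ∣_) (sym ∣Y∣≡0) (∣ ⟨g⟩ ∣ ∣0)
      ... | no ∣Y∣≢0 with ∣∣-witness Y (n≢0⇒n>0 ∣Y∣≢0) | c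
      ...   | _ , _ | zero = ⊥-elim (∣Y∣≢0 (n≤0⇒n≡0 ∣Y∣≤c))
      ...   | y , y∈Y | suc c =
        subst (∣ ⟨g⟩ ∣ ∣_) (sym orbit) (∣m∣n⇒∣m+n ∣-refl (go c _ (∖orbit-closed closed y∈Y) rest≤c))
        where
        orbit = ∣∣-orbit closed y∈Y
        rest≤c : ∣ Y ∖ ⟨g⟩ ▹ y ∣ ≤ c
        rest≤c = s≤s⁻¹ (≤-trans (+-monoˡ-≤ _ ∣⟨g⟩∣>0) (subst (_≤ suc c) orbit ∣Y∣≤c))

    -- The first power of g outside X is the only element of g ◃ X outside X, so X ∪ ⟨g⟩ is closed.
    module _ {X : Subset Carrier} (ε∈X : ε ∈ X) (g⁻¹∉X : g ⁻¹ ∉ X)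
             (grows-by-one : ∣ X ∪ g ◃ X ∣ ≤ suc ∣ X ∣) where

      escape : ∃[ u ] (u ∈ ⟨g⟩ × u ∈ g ◃ X ∖ X)
      escape with boundary (λ i → X (power i g)) ε∈X (k ∸ 1) (subst (_∉ X) g⁻¹≡power g⁻¹∉X)
      ... | i , gⁱ∈X , gⁱ⁺¹∉X = power (suc i) g , power-∈ (suc i) ,
                                 ∖-intro {A = g ◃ X} {B = X} (∙-∈-◃ {X} g gⁱ∈X) gⁱ⁺¹∉X

      X∪⟨g⟩-closed : LeftClosed (X ∪ ⟨g⟩)
      X∪⟨g⟩-closed x x∈ with ∪-elim {A = X} {B = ⟨g⟩} x∈
      ... | inj₂ x∈⟨g⟩ = ∪-introʳ {A = X} {B = ⟨g⟩} (g∙-∈ x∈⟨g⟩)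
      ... | inj₁ x∈X with X (g ∙ x) in gx∈?X
      ...   | true = refl
      ...   | false = subst (_∈ ⟨g⟩) (∣∪∣≤suc⇒unique X (g ◃ X) grows-by-one u∈new gx∈new) u∈⟨g⟩
        where
        u∈⟨g⟩ = proj₁ (proj₂ escape)
        u∈new = proj₂ (proj₂ escape)
        gx∈new : g ∙ x ∈ g ◃ X ∖ X
        gx∈new = ∖-intro {A = g ◃ X} {B = X} (∙-∈-◃ {X} g x∈X) gx∈?X

      ∣⟨g⟩∣∤∣X∣ : ¬ (∣ ⟨g⟩ ∣ ∣ ∣ X ∣)
      ∣⟨g⟩∣∤∣X∣ ∣⟨g⟩∣∣∣X∣ = <⇒≱ d<∣⟨g⟩∣ (∣⇒≤ {{>-nonZero d>0}} ∣⟨g⟩∣∣d)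
        where
        d = ∣ ⟨g⟩ ∖ X ∣
        d>0 : 0 < d
        d>0 = ∣∣-pos (⟨g⟩ ∖ X) (∖-intro {A = ⟨g⟩} {B = X} g⁻¹∈⟨g⟩ g⁻¹∉X)
          where
          g⁻¹∈⟨g⟩ : g ⁻¹ ∈ ⟨g⟩
          g⁻¹∈⟨g⟩ = subst (_∈ ⟨g⟩) (sym g⁻¹≡power) (power-∈ (k ∸ 1))
        d<∣⟨g⟩∣ : d < ∣ ⟨g⟩ ∣
        d<∣⟨g⟩∣ = begin-strict
          d                 <⟨ +-monoˡ-≤ d (∣∣-pos (⟨g⟩ ∩ X) (∩-intro {A = ⟨g⟩} {B = X} (power-∈ 0) ε∈X)) ⟩
          ∣ ⟨g⟩ ∩ X ∣ + d   ≡⟨ ∣∣-split ⟨g⟩ X ⟨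
          ∣ ⟨g⟩ ∣           ∎
          where open ≤-Reasoning
        ∣⟨g⟩∣∣d : ∣ ⟨g⟩ ∣ ∣ d
        ∣⟨g⟩∣∣d = ∣m+n∣m⇒∣n (subst (∣ ⟨g⟩ ∣ ∣_) (∣∪∣ X ⟨g⟩) (∣⟨g⟩∣-divides-closed _ X∪⟨g⟩-closed))
                            ∣⟨g⟩∣∣∣X∣

  almost-invariant-≢-invariant : ∀ g {X Y} → ε ∈ X → g ⁻¹ ∉ X →
    ∣ X ∪ g ◃ X ∣ ≤ suc ∣ X ∣ → ∣ Y ∪ g ◃ Y ∣ ≤ ∣ Y ∣ → ∣ X ∣ ≢ ∣ Y ∣
  almost-invariant-≢-invariant g {X} {Y} ε∈X g⁻¹∉X X-grows Y-invariant ∣X∣≡∣Y∣ with finite-order g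
  ... | k , k>0 , gᵏ≡ε =
    ∣⟨g⟩∣∤∣X∣ {X} ε∈X g⁻¹∉X X-grows (subst (∣ ⟨g⟩ ∣ ∣_) (sym ∣X∣≡∣Y∣) (∣⟨g⟩∣-divides-closed Y Y-closed))
    where
    open Cyclic g k>0 gᵏ≡ε
    Y-closed : LeftClosed Y
    Y-closed y y∈Y = ∣∪∣≤⇒⊆ Y (g ◃ Y) Y-invariant (g ∙ y) (∙-∈-◃ {Y} g y∈Y)

-- Products of subsequences

module Subproducts (G : FiniteGroup) where

  open FiniteGroup G
  open FiniteGroupTheory G
  open MonoidProperties monoid using (cancelˡ)

  Subproduct : ∀ {k} → (Fin k → Carrier) → Carrier → Set
  Subproduct {k} g x =
    ∃[ m ] Σ (Fin m → Fin k) λ i → StrictlyIncreasing rawMonoid i × prod rawMonoid (g ∘ i) ≡ x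

  ZeroSubproduct : ∀ {k} → (Fin k → Carrier) → Set
  ZeroSubproduct {k} g =
    ∃[ m ] Σ (Fin (suc m) → Fin k) λ i → StrictlyIncreasing rawMonoid i × prod rawMonoid (g ∘ i) ≡ ε

  subproducts : ∀ {k} → (Fin k → Carrier) → Subset Carrier
  subproducts {zero} g = ｛ ε ｝
  subproducts {suc k} g = subproducts (tail g) ∪ head g ◃ subproducts (tail g)

  ε-∈-subproducts : ∀ {k} (g : Fin k → Carrier) → ε ∈ subproducts g
  ε-∈-subproducts {zero} g = dec-true (ε ≟ ε) refl
  ε-∈-subproducts {suc k} g = ⊆-∪ˡ (subproducts (tail g)) (head g ◃ subproducts (tail g)) ε (ε-∈-subproducts (tail g))

  suc-increasing : ∀ {m k} {i : Fin m → Fin k} → StrictlyIncreasing rawMonoid i →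
    StrictlyIncreasing rawMonoid (suc ∘ i)
  suc-increasing inc a b a<b = s≤s (inc a b a<b)

  cons-increasing : ∀ {m k} {i : Fin m → Fin k} → StrictlyIncreasing rawMonoid i →
    StrictlyIncreasing rawMonoid (zero ∷ suc ∘ i)
  cons-increasing inc zero (suc b) _ = s≤s z≤n
  cons-increasing inc (suc a) (suc b) a<b = s≤s (inc a b (s≤s⁻¹ a<b))

  subproducts-sound : ∀ {k} (g : Fin k → Carrier) {x} → x ∈ subproducts g → Subproduct g x
  subproducts-sound {zero} g x∈｛ε｝ = 0 , (λ ()) , (λ ()) , sym (∈｛｝⇒≡ x∈｛ε｝)
  subproducts-sound {suc k} g {x} x∈ with ∪-elim {A = subproducts (tail g)} {B = head g ◃ subproducts (tail g)} x∈
  ... | inj₁ x∈skip = let m , i , inc , Πᵢ≡x = subproducts-sound (tail g) x∈skip in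
    m , suc ∘ i , suc-increasing inc , Πᵢ≡x
  ... | inj₂ x∈take = let m , i , inc , Πᵢ≡g₀⁻¹x = subproducts-sound (tail g) x∈take in
    suc m , zero ∷ suc ∘ i , cons-increasing inc ,
    trans (cong (head g ∙_) Πᵢ≡g₀⁻¹x) (cancelˡ (inverseʳ (head g)) x)

  zero-subproduct-of-tail : ∀ {k} (g : Fin (suc k) → Carrier) → ZeroSubproduct (tail g) → ZeroSubproduct g
  zero-subproduct-of-tail g (m , i , inc , Πᵢ≡ε) = m , suc ∘ i , suc-increasing inc , Πᵢ≡ε

  zero-subproduct-of-head : ∀ {k} (g : Fin (suc k) → Carrier) → head g ⁻¹ ∈ subproducts (tail g) →
    ZeroSubproduct g
  zero-subproduct-of-head g g₀⁻¹∈ = let m , i , inc , Πᵢ≡g₀⁻¹ = subproducts-sound (tail g) g₀⁻¹∈ in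
    m , zero ∷ suc ∘ i , cons-increasing inc , trans (cong (head g ∙_) Πᵢ≡g₀⁻¹) (inverseʳ (head g))

  subproducts-step : (P Q : Subset Carrier → Set) →
    (∀ {A h} → ε ∈ A → h ⁻¹ ∉ A → P A → Q (A ∪ h ◃ A)) →
    ∀ {k} (g : Fin (suc k) → Carrier) →
    ZeroSubproduct (tail g) ⊎ P (subproducts (tail g)) → ZeroSubproduct g ⊎ Q (subproducts g)
  subproducts-step P Q step g (inj₁ zero-tail) = inj₁ (zero-subproduct-of-tail g zero-tail)
  subproducts-step P Q step g (inj₂ P-tail) with subproducts (tail g) (head g ⁻¹) in g₀⁻¹∈?
  ... | true = inj₁ (zero-subproduct-of-head g g₀⁻¹∈?)
  ... | false = inj₂ (step (ε-∈-subproducts (tail g)) g₀⁻¹∈? P-tail)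

-- The Klein four-group

V : Set
V = Bool × Bool

𝟘 : V
𝟘 = false , false

infixl 6 _⊕_
_⊕_ : V → V → V
(a , b) ⊕ (c , d) = a xor c , b xor d

infix 4 _≟ⱽ_
_≟ⱽ_ : (u v : V) → Dec (u ≡ v)
_≟ⱽ_ = ≡-dec Bool._≟_ Bool._≟_

｛_｝ⱽ : V → Subset V
｛ v ｝ⱽ u = does (u ≟ⱽ v)

pair : V → V → Subset V
pair v w = ｛ v ｝ⱽ ∪ ｛ w ｝ⱽ

all-Bool? : {P : Bool → Set} → (∀ b → Dec (P b)) → Dec (∀ b → P b)
all-Bool? P? = map′ (λ (p₀ , p₁) → λ { false → p₀ ; true → p₁ }) (λ p → p false , p true)
                    (P? false ×-dec P? true)

any-Bool? : {P : Bool → Set} → (∀ b → Dec (P b)) → Dec (∃ P)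
any-Bool? P? = map′ (λ { (inj₁ p) → false , p ; (inj₂ p) → true , p })
                    (λ { (false , p) → inj₁ p ; (true , p) → inj₂ p })
                    (P? false ⊎-dec P? true)

all-V? : {P : V → Set} → (∀ v → Dec (P v)) → Dec (∀ v → P v)
all-V? P? = map′ (λ p (a , b) → p a b) (λ p a b → p (a , b)) (all-Bool? λ a → all-Bool? λ b → P? (a , b))

any-V? : {P : V → Set} → (∀ v → Dec (P v)) → Dec (∃ P)
any-V? P? = map′ (λ (a , b , p) → (a , b) , p) (λ ((a , b) , p) → a , b , p)
                 (any-Bool? λ a → any-Bool? λ b → P? (a , b))

⊕-self : ∀ u → u ⊕ u ≡ 𝟘
⊕-self = toWitness {a? = all-V? λ u → u ⊕ u ≟ⱽ 𝟘} _

⊕-identityʳ : ∀ u → u ⊕ 𝟘 ≡ u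
⊕-identityʳ = toWitness {a? = all-V? λ u → u ⊕ 𝟘 ≟ⱽ u} _

⊕-cancelˡ : ∀ t u → t ⊕ (t ⊕ u) ≡ u
⊕-cancelˡ = toWitness {a? = all-V? λ t → all-V? λ u → t ⊕ (t ⊕ u) ≟ⱽ u} _

⊕≡𝟘 : ∀ u v → u ⊕ v ≡ 𝟘 → u ≡ v
⊕≡𝟘 = toWitness {a? = all-V? λ u → all-V? λ v → u ⊕ v ≟ⱽ 𝟘 →-dec u ≟ⱽ v} _

⊕-≟ : ∀ t u v → does (t ⊕ u ≟ⱽ v) ≡ does (u ≟ⱽ t ⊕ v)
⊕-≟ = toWitness {a? = all-V? λ t → all-V? λ u → all-V? λ v →
  does (t ⊕ u ≟ⱽ v) Bool.≟ does (u ≟ⱽ t ⊕ v)} _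

nonzero-cover : ∀ t v u → t ≢ 𝟘 → v ≢ 𝟘 → v ≢ t → u ≢ 𝟘 → u ≡ t ⊎ u ≡ v ⊎ u ≡ t ⊕ v
nonzero-cover = toWitness {a? = all-V? λ t → all-V? λ v → all-V? λ u →
  ¬? (t ≟ⱽ 𝟘) →-dec ¬? (v ≟ⱽ 𝟘) →-dec ¬? (v ≟ⱽ t) →-dec ¬? (u ≟ⱽ 𝟘) →-dec
  (u ≟ⱽ t ⊎-dec u ≟ⱽ v ⊎-dec u ≟ⱽ t ⊕ v)} _

coset : V → V → Subset V
coset w a = pair a (w ⊕ a)

coset-stable : ∀ t w a u → t ≡ 𝟘 ⊎ t ≡ w → coset w a (t ⊕ u) ≡ coset w a u
coset-stable = toWitness {a? = all-V? λ t → all-V? λ w → all-V? λ a → all-V? λ u →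
  (t ≟ⱽ 𝟘 ⊎-dec t ≟ⱽ w) →-dec coset w a (t ⊕ u) Bool.≟ coset w a u} _

⊕-≢-self : ∀ w a → w ≢ 𝟘 → a ≢ w ⊕ a
⊕-≢-self = toWitness {a? = all-V? λ w → all-V? λ a → ¬? (w ≟ⱽ 𝟘) →-dec ¬? (a ≟ⱽ w ⊕ a)} _

axis : ∀ t → ∃[ w ] (w ≢ 𝟘 × (t ≡ 𝟘 ⊎ t ≡ w))
axis = toWitness {a? = all-V? λ t → any-V? λ w → ¬? (w ≟ⱽ 𝟘) ×-dec (t ≟ⱽ 𝟘 ⊎-dec t ≟ⱽ w)} _

off-axis : ∀ w → ∃[ v ] (v ≢ 𝟘 × w ⊕ v ≢ 𝟘)
off-axis = toWitness {a? = all-V? λ w → any-V? λ v → ¬? (v ≟ⱽ 𝟘) ×-dec ¬? (w ⊕ v ≟ⱽ 𝟘)} _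

pair-complement : ∀ u → not (pair 𝟘 (false , true) u) ≡ pair (true , false) (true , true) u
pair-complement = toWitness {a? = all-V? λ u →
  not (pair 𝟘 (false , true) u) Bool.≟ pair (true , false) (true , true) u} _

｛｝ⱽ-disjoint : ∀ u w z → u ≢ w → z ∈ ｛ u ｝ⱽ → z ∉ ｛ w ｝ⱽ
｛｝ⱽ-disjoint = toWitness {a? = all-V? λ u → all-V? λ w → all-V? λ z →
  ¬? (u ≟ⱽ w) →-dec ｛ u ｝ⱽ z Bool.≟ true →-dec ｛ w ｝ⱽ z Bool.≟ false} _

-- Finite groups over the Klein four-group

module KleinQuotient (G : FiniteGroup) (τ : FiniteGroup.Carrier G → V)
                     (τ-hom : ∀ x y → τ (FiniteGroup._∙_ G x y) ≡ τ x ⊕ τ y) where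

  open FiniteGroup G
  open FiniteGroupTheory G
  open Subproducts G

  τ-ε : τ ε ≡ 𝟘
  τ-ε = trans (cong τ (sym (identityˡ ε))) (trans (τ-hom ε ε) (⊕-self (τ ε)))

  τ-⁻¹∙ : ∀ g x → τ (g ⁻¹ ∙ x) ≡ τ g ⊕ τ x
  τ-⁻¹∙ g x = trans (τ-hom (g ⁻¹) x) (cong (_⊕ τ x) τ-⁻¹)
    where
    τ-⁻¹ : τ (g ⁻¹) ≡ τ g
    τ-⁻¹ = ⊕≡𝟘 _ _ (trans (sym (τ-hom (g ⁻¹) g)) (trans (cong τ (inverseˡ g)) τ-ε))

  infixl 7 _⇂_
  _⇂_ : Subset Carrier → Subset V → Subset Carrier
  A ⇂ W = A ∩ W ∘ τ

  layer : Subset Carrier → V → ℕ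
  layer A v = ∣ A ⇂ ｛ v ｝ⱽ ∣

  kernel : Subset Carrier
  kernel = ｛ 𝟘 ｝ⱽ ∘ τ

  layer-◃ : ∀ g A v → ∣ g ◃ A ⇂ ｛ v ｝ⱽ ∣ ≡ layer A (τ g ⊕ v)
  layer-◃ g A v = begin
    ∣ g ◃ A ⇂ ｛ v ｝ⱽ ∣                  ≡⟨ ∣∣-cong translate ⟩
    ∣ g ◃ (A ⇂ ｛ v ｝ⱽ ∘ (τ g ⊕_)) ∣     ≡⟨ ∣◃∣ g (A ⇂ ｛ v ｝ⱽ ∘ (τ g ⊕_)) ⟩
    ∣ A ⇂ ｛ v ｝ⱽ ∘ (τ g ⊕_) ∣           ≡⟨ ∣∣-cong (λ x → cong (A x ∧_) (⊕-≟ (τ g) (τ x) v)) ⟩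
    layer A (τ g ⊕ v)                    ∎
    where
    open ≡-Reasoning
    translate : ∀ x → (g ◃ A ⇂ ｛ v ｝ⱽ) x ≡ (g ◃ (A ⇂ ｛ v ｝ⱽ ∘ (τ g ⊕_))) x
    translate x = cong (λ u → A (g ⁻¹ ∙ x) ∧ ｛ v ｝ⱽ u)
                       (sym (trans (cong (τ g ⊕_) (τ-⁻¹∙ g x)) (⊕-cancelˡ (τ g) (τ x))))

  layer-pair : ∀ A {u w} → u ≢ w → ∣ A ⇂ pair u w ∣ ≡ layer A u + layer A w
  layer-pair A {u} {w} u≢w = begin
    ∣ A ⇂ pair u w ∣
      ≡⟨ ∣∣-split (A ⇂ pair u w) (｛ u ｝ⱽ ∘ τ) ⟩
    ∣ (A ⇂ pair u w) ∩ ｛ u ｝ⱽ ∘ τ ∣ + ∣ (A ⇂ pair u w) ∖ ｛ u ｝ⱽ ∘ τ ∣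
      ≡⟨ cong₂ _+_ (∣∣-cong λ x → first (A x) (｛ u ｝ⱽ (τ x)) (｛ w ｝ⱽ (τ x)))
                   (∣∣-cong λ x → second (A x) (｛ u ｝ⱽ (τ x)) (｛ w ｝ⱽ (τ x)) (｛｝ⱽ-disjoint u w (τ x) u≢w)) ⟩
    layer A u + layer A w
      ∎
    where
    open ≡-Reasoning
    first : ∀ a p q → (a ∧ (p ∨ q)) ∧ p ≡ a ∧ p
    first false p q = refl
    first true false q = ∧-zeroʳ q
    first true true q = refl
    second : ∀ a p q → (p ≡ true → q ≡ false) → (a ∧ (p ∨ q)) ∧ not p ≡ a ∧ q
    second false p q _ = refl
    second true false q _ = ∧-identityʳ q
    second true true q p⇒¬q = sym (p⇒¬q refl)

  layer𝟘≤∣kernel∣ : ∀ A → layer A 𝟘 ≤ ∣ kernel ∣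
  layer𝟘≤∣kernel∣ A = ∣∣-mono (∩-⊆ʳ A kernel)

  ε-∈-kernel-layer : ∀ {A} → ε ∈ A → ε ∈ A ⇂ ｛ 𝟘 ｝ⱽ
  ε-∈-kernel-layer {A} ε∈A = ∩-intro {A = A} {B = ｛ 𝟘 ｝ⱽ ∘ τ} ε∈A (cong (λ u → does (u ≟ⱽ 𝟘)) τ-ε)

  -- Lower bounds on the fibres of the subproducts of 2s, resp. 2s+1, elements.
  EvenBound : Subset Carrier → ℕ → Set
  EvenBound A s = s ≤ layer A 𝟘 × (s < layer A 𝟘 ⊎ (∀ v → v ≢ 𝟘 → s ≤ layer A v))

  OddBound : Subset Carrier → ℕ → Set
  OddBound A s = s < layer A 𝟘 × (suc s < layer A 𝟘 ⊎ ∃[ v ] (v ≢ 𝟘 × s < layer A v))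

  module Extension {A : Subset Carrier} {g : Carrier} (ε∈A : ε ∈ A) (g⁻¹∉A : g ⁻¹ ∉ A) where

    A′ : Subset Carrier
    A′ = A ∪ g ◃ A

    t : V
    t = τ g

    layer-grows : ∀ v → layer A v ≤ layer A′ v
    layer-grows v = ∣∣-mono (∩-monoˡ (｛ v ｝ⱽ ∘ τ) (⊆-∪ˡ A (g ◃ A)))

    layer-shifts : ∀ v → layer A (t ⊕ v) ≤ layer A′ v
    layer-shifts v = subst (_≤ layer A′ v) (layer-◃ g A v)
                           (∣∣-mono (∩-monoˡ (｛ v ｝ⱽ ∘ τ) (⊆-∪ʳ A (g ◃ A))))

    layer-shifts-into-𝟘 : suc (layer A t) ≤ layer A′ 𝟘
    layer-shifts-into-𝟘 =
      subst (λ n → suc n ≤ layer A′ 𝟘) (trans (layer-◃ g A 𝟘) (cong (layer A) (⊕-identityʳ t)))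
            (∣∣-strict (∩-monoˡ (｛ 𝟘 ｝ⱽ ∘ τ) (⊆-∪ʳ A (g ◃ A))) ε∉g◃A ε∈A′)
      where
      ε∉g◃A : ε ∉ g ◃ A ⇂ ｛ 𝟘 ｝ⱽ
      ε∉g◃A rewrite identityʳ (g ⁻¹) | g⁻¹∉A = refl
      ε∈A′ : ε ∈ A′ ⇂ ｛ 𝟘 ｝ⱽ
      ε∈A′ = ε-∈-kernel-layer {A′} (⊆-∪ˡ A (g ◃ A) ε ε∈A)

    layer-t⊕t : ∀ B → layer B (t ⊕ t) ≡ layer B 𝟘
    layer-t⊕t B = cong (layer B) (⊕-self t)

    ⇂-extension : ∀ W → (∀ u → W (t ⊕ u) ≡ W u) → ∀ x → ((A ⇂ W) ∪ g ◃ (A ⇂ W)) x ≡ (A′ ⇂ W) x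
    ⇂-extension W W-stable x =
      trans (cong (λ b → A x ∧ W (τ x) ∨ A (g ⁻¹ ∙ x) ∧ b) (trans (cong W (τ-⁻¹∙ g x)) (W-stable (τ x))))
            (sym (∧-distribʳ-∨ (W (τ x)) (A x) (A (g ⁻¹ ∙ x))))

    layers-flat : ∀ {s} → (∀ v → s ≤ layer A v) →
      layer A′ 𝟘 ≤ suc s → (∀ v → v ≢ 𝟘 → layer A′ v ≤ s) → ∀ v → layer A v ≡ s
    layers-flat {s} s≤ A′₀≤ A′≤ v = ≤-antisym (≤s v) (s≤ v)
      where
      ≤s : ∀ v → layer A v ≤ s
      ≤s v with v ≟ⱽ 𝟘
      ... | no v≢𝟘 = ≤-trans (layer-grows v) (A′≤ v v≢𝟘)
      ... | yes refl with t ≟ⱽ 𝟘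
      ...   | yes t≡𝟘 = subst (λ u → layer A u ≤ s) t≡𝟘 (s≤s⁻¹ (≤-trans layer-shifts-into-𝟘 A′₀≤))
      ...   | no t≢𝟘 = ≤-trans (≤-reflexive (sym (layer-t⊕t A))) (≤-trans (layer-shifts t) (A′≤ t t≢𝟘))

    -- coset w 𝟘 = {𝟘, w} is a subgroup containing t and coset w v avoids 𝟘: the part of A over the
    -- first grows by one under g, the part over the second does not grow, yet both have 2s elements.
    no-flat-extension : ∀ {s} → (∀ v → layer A v ≡ s) →
      layer A′ 𝟘 ≤ suc s → (∀ v → v ≢ 𝟘 → layer A′ v ≤ s) → ⊥
    no-flat-extension {s} flat A′₀≤ A′≤ =
      almost-invariant-≢-invariant g {A ⇂ coset w 𝟘} {A ⇂ coset w v} ε∈X g⁻¹∉X X-grows Y-invariant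
        (trans (∣A⇂coset∣ 𝟘) (sym (∣A⇂coset∣ v)))
      where
      w = proj₁ (axis t)
      w≢𝟘 = proj₁ (proj₂ (axis t))
      t∈⟨w⟩ = proj₂ (proj₂ (axis t))
      w⊕𝟘≢𝟘 = w≢𝟘 ∘ trans (sym (⊕-identityʳ w))
      v = proj₁ (off-axis w)
      v≢𝟘 = proj₁ (proj₂ (off-axis w))
      w⊕v≢𝟘 = proj₂ (proj₂ (off-axis w))

      ∣⇂coset∣ : ∀ B a → ∣ B ⇂ coset w a ∣ ≡ layer B a + layer B (w ⊕ a)
      ∣⇂coset∣ B a = layer-pair B (⊕-≢-self w a w≢𝟘)

      ∣A⇂coset∣ : ∀ a → ∣ A ⇂ coset w a ∣ ≡ s + s
      ∣A⇂coset∣ a = trans (∣⇂coset∣ A a) (cong₂ _+_ (flat a) (flat (w ⊕ a)))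

      ∣extended-coset∣ : ∀ a →
        ∣ (A ⇂ coset w a) ∪ g ◃ (A ⇂ coset w a) ∣ ≡ layer A′ a + layer A′ (w ⊕ a)
      ∣extended-coset∣ a =
        trans (∣∣-cong (⇂-extension (coset w a) λ u → coset-stable t w a u t∈⟨w⟩)) (∣⇂coset∣ A′ a)

      ε∈X : ε ∈ A ⇂ coset w 𝟘
      ε∈X = ∩-intro {A = A} {B = coset w 𝟘 ∘ τ} ε∈A (subst (λ u → coset w 𝟘 u ≡ true) (sym τ-ε) refl)

      g⁻¹∉X : g ⁻¹ ∉ A ⇂ coset w 𝟘
      g⁻¹∉X rewrite g⁻¹∉A = refl

      X-grows : ∣ (A ⇂ coset w 𝟘) ∪ g ◃ (A ⇂ coset w 𝟘) ∣ ≤ suc ∣ A ⇂ coset w 𝟘 ∣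
      X-grows = begin
        ∣ (A ⇂ coset w 𝟘) ∪ g ◃ (A ⇂ coset w 𝟘) ∣  ≡⟨ ∣extended-coset∣ 𝟘 ⟩
        layer A′ 𝟘 + layer A′ (w ⊕ 𝟘)              ≤⟨ +-mono-≤ A′₀≤ (A′≤ (w ⊕ 𝟘) w⊕𝟘≢𝟘) ⟩
        suc s + s                                  ≡⟨ cong suc (∣A⇂coset∣ 𝟘) ⟨
        suc ∣ A ⇂ coset w 𝟘 ∣                      ∎
        where open ≤-Reasoning

      Y-invariant : ∣ (A ⇂ coset w v) ∪ g ◃ (A ⇂ coset w v) ∣ ≤ ∣ A ⇂ coset w v ∣
      Y-invariant = begin
        ∣ (A ⇂ coset w v) ∪ g ◃ (A ⇂ coset w v) ∣  ≡⟨ ∣extended-coset∣ v ⟩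
        layer A′ v + layer A′ (w ⊕ v)              ≤⟨ +-mono-≤ (A′≤ v v≢𝟘) (A′≤ (w ⊕ v) w⊕v≢𝟘) ⟩
        s + s                                      ≡⟨ ∣A⇂coset∣ v ⟨
        ∣ A ⇂ coset w v ∣                          ∎
        where open ≤-Reasoning

    even→odd : ∀ {s} → EvenBound A s → OddBound A′ s
    even→odd {s} (s≤a₀ , inj₁ s<a₀) = <-≤-trans s<a₀ (layer-grows 𝟘) , grown
      where
      grown : suc s < layer A′ 𝟘 ⊎ ∃[ v ] (v ≢ 𝟘 × s < layer A′ v)
      grown with t ≟ⱽ 𝟘
      ... | yes t≡𝟘 = inj₁ (≤-trans (s≤s (subst (λ u → s < layer A u) (sym t≡𝟘) s<a₀)) layer-shifts-into-𝟘)
      ... | no t≢𝟘 = inj₂ (t , t≢𝟘 , <-≤-trans s<a₀ (subst (_≤ layer A′ t) (layer-t⊕t A) (layer-shifts t)))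
    even→odd {s} (s≤a₀ , inj₂ s≤aᵥ) = ≤-trans (s≤s (s≤ t)) layer-shifts-into-𝟘 , grown
      where
      s≤ : ∀ v → s ≤ layer A v
      s≤ v with v ≟ⱽ 𝟘
      ... | yes refl = s≤a₀
      ... | no v≢𝟘 = s≤aᵥ v v≢𝟘
      grown : suc s < layer A′ 𝟘 ⊎ ∃[ v ] (v ≢ 𝟘 × s < layer A′ v)
      grown with suc s <? layer A′ 𝟘 | any-V? (λ v → ¬? (v ≟ⱽ 𝟘) ×-dec s <? layer A′ v)
      ... | yes ss<a′₀ | _ = inj₁ ss<a′₀
      ... | no _ | yes grows = inj₂ grows
      ... | no ss≮a′₀ | no ¬grows = ⊥-elim (no-flat-extension (layers-flat s≤ A′₀≤ A′≤) A′₀≤ A′≤)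
        where
        A′₀≤ : layer A′ 𝟘 ≤ suc s
        A′₀≤ = ≮⇒≥ ss≮a′₀
        A′≤ : ∀ v → v ≢ 𝟘 → layer A′ v ≤ s
        A′≤ v v≢𝟘 = ≮⇒≥ λ s<a′ᵥ → ¬grows (v , v≢𝟘 , s<a′ᵥ)

    odd→even : ∀ {s} → OddBound A s → EvenBound A′ (suc s)
    odd→even {s} (s<a₀ , rest) = ≤-trans s<a₀ (layer-grows 𝟘) , grown rest
      where
      grown : suc s < layer A 𝟘 ⊎ ∃[ v ] (v ≢ 𝟘 × s < layer A v) →
              suc s < layer A′ 𝟘 ⊎ (∀ u → u ≢ 𝟘 → suc s ≤ layer A′ u)
      grown _ with t ≟ⱽ 𝟘
      grown _ | yes t≡𝟘 = inj₁ (≤-trans (s≤s (subst (λ u → s < layer A u) (sym t≡𝟘) s<a₀)) layer-shifts-into-𝟘)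
      grown (inj₁ ss<a₀) | no _ = inj₁ (<-≤-trans ss<a₀ (layer-grows 𝟘))
      grown (inj₂ (v , v≢𝟘 , s<aᵥ)) | no t≢𝟘 with v ≟ⱽ t
      ... | yes refl = inj₁ (≤-trans (s≤s s<aᵥ) layer-shifts-into-𝟘)
      ... | no v≢t = inj₂ λ u u≢𝟘 → covered u (nonzero-cover t v u t≢𝟘 v≢𝟘 v≢t u≢𝟘)
        where
        covered : ∀ u → u ≡ t ⊎ u ≡ v ⊎ u ≡ t ⊕ v → suc s ≤ layer A′ u
        covered u (inj₁ refl) = ≤-trans s<a₀ (subst (_≤ layer A′ t) (layer-t⊕t A) (layer-shifts t))
        covered u (inj₂ (inj₁ refl)) = ≤-trans s<aᵥ (layer-grows v)
        covered u (inj₂ (inj₂ refl)) =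
          ≤-trans s<aᵥ (subst (_≤ layer A′ (t ⊕ v)) (cong (layer A) (⊕-cancelˡ t v)) (layer-shifts (t ⊕ v)))

  -- The length is given by an equation so that the recursion is on s.
  even-stage : ∀ s {k} → k ≡ s + s → (g : Fin k → Carrier) → ZeroSubproduct g ⊎ EvenBound (subproducts g) s
  odd-stage : ∀ s {k} → k ≡ suc (s + s) → (g : Fin k → Carrier) → ZeroSubproduct g ⊎ OddBound (subproducts g) s

  even-stage zero {zero} refl g =
    inj₂ (z≤n , inj₁ (∣∣-pos (subproducts g ⇂ ｛ 𝟘 ｝ⱽ)
                              (ε-∈-kernel-layer {subproducts g} (ε-∈-subproducts g))))
  even-stage (suc s) {suc k} k≡ g =
    subproducts-step (λ A → OddBound A s) (λ A → EvenBound A (suc s))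
                     (λ {A} {h} ε∈A h⁻¹∉A → Extension.odd→even {A} {h} ε∈A h⁻¹∉A) g
                     (odd-stage s (trans (suc-injective k≡) (+-suc s s)) (tail g))
  odd-stage s {suc k} k≡ g =
    subproducts-step (λ A → EvenBound A s) (λ A → OddBound A s)
                     (λ {A} {h} ε∈A h⁻¹∉A → Extension.even→odd {A} {h} ε∈A h⁻¹∉A) g
                     (even-stage s (suc-injective k≡) (tail g))

  davenport-bound : ∀ {m k} → k ≡ suc (m + m) → ∣ kernel ∣ ≤ m → DProp rawMonoid k
  davenport-bound {m} k≡ ∣kernel∣≤m g with odd-stage m k≡ g
  ... | inj₁ zero-subproduct = zero-subproduct
  ... | inj₂ (m<a₀ , _) = ⊥-elim (<⇒≱ m<a₀ (≤-trans (layer𝟘≤∣kernel∣ (subproducts g)) ∣kernel∣≤m))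

  size≡4∣kernel∣ : (∀ v → ∃[ h ] τ h ≡ v) →
    size ≡ (∣ kernel ∣ + ∣ kernel ∣) + (∣ kernel ∣ + ∣ kernel ∣)
  size≡4∣kernel∣ τ-surjective = begin
    size
      ≡⟨ count-all size ⟨
    ∣ full ∣
      ≡⟨ ∣∣-split full (pair 𝟘 (false , true) ∘ τ) ⟩
    ∣ full ⇂ pair 𝟘 (false , true) ∣ + ∣ full ∖ pair 𝟘 (false , true) ∘ τ ∣
      ≡⟨ cong₂ _+_ (layer-pair full (λ ())) (trans (∣∣-cong (pair-complement ∘ τ)) (layer-pair full (λ ()))) ⟩
    (layer full 𝟘 + layer full (false , true)) + (layer full (true , false) + layer full (true , true))
      ≡⟨ cong₂ _+_ (cong₂ _+_ (fibre 𝟘) (fibre _)) (cong₂ _+_ (fibre _) (fibre _)) ⟩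
    (∣ kernel ∣ + ∣ kernel ∣) + (∣ kernel ∣ + ∣ kernel ∣)
      ∎
    where
    open ≡-Reasoning
    fibre : ∀ v → layer full v ≡ ∣ kernel ∣
    fibre v = let h , τh≡v = τ-surjective v in
      sym (trans (layer-◃ h full 𝟘) (cong (layer full) (trans (⊕-identityʳ (τ h)) τh≡v)))

-- The modular group M_{2^r}

parity : ℕ → Bool
parity zero = false
parity (suc n) = not (parity n)

parity-+ : ∀ m n → parity (m + n) ≡ parity m xor parity n
parity-+ zero n = refl
parity-+ (suc m) n = trans (cong not (parity-+ m n)) (not-distribˡ-xor (parity m) (parity n))

parity-* : ∀ m n → parity (m * n) ≡ parity m ∧ parity n
parity-* zero n = refl
parity-* (suc m) n =
  trans (parity-+ n (m * n)) (trans (cong (parity n xor_) (parity-* m n)) (xor-∧ (parity m) (parity n)))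
  where
  xor-∧ : ∀ a b → b xor (a ∧ b) ≡ not a ∧ b
  xor-∧ false b = xor-identityʳ b
  xor-∧ true false = refl
  xor-∧ true true = refl

parity-% : ∀ m n .{{_ : NonZero n}} → parity n ≡ false → parity (m % n) ≡ parity m
parity-% m n n-even = sym (begin
  parity m                                   ≡⟨ cong parity (m≡m%n+[m/n]*n m n) ⟩
  parity (m % n + m / n * n)                 ≡⟨ parity-+ (m % n) (m / n * n) ⟩
  parity (m % n) xor parity (m / n * n)      ≡⟨ cong (parity (m % n) xor_) (parity-* (m / n) n) ⟩
  parity (m % n) xor (parity (m / n) ∧ parity n)
                                             ≡⟨ cong (λ p → parity (m % n) xor (parity (m / n) ∧ p)) n-even ⟩
  parity (m % n) xor (parity (m / n) ∧ false) ≡⟨ cong (parity (m % n) xor_) (∧-zeroʳ (parity (m / n))) ⟩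
  parity (m % n) xor false                   ≡⟨ xor-identityʳ (parity (m % n)) ⟩
  parity (m % n)                             ∎)
  where open ≡-Reasoning

bit : Fin 2 → Bool
bit zero = false
bit (suc zero) = true

module Modular (t : ℕ) where

  r : ℕ
  r = 4 + t

  N : ℕ
  N = 2 ^ (r ∸ 1)

  instance
    N≢0 : NonZero N
    N≢0 = m^n≢0 2 (r ∸ 1)

  twist : ℕ
  twist = 1 + 2 ^ (r ∸ 2)

  [_] : ℕ → Fin N
  [ n ] = n mod N

  toℕ-[] : ∀ n → toℕ [ n ] ≡ n % N
  toℕ-[] n = Finₚ.toℕ-fromℕ< _

  []-cong : ∀ {m n} → m % N ≡ n % N → [ m ] ≡ [ n ]
  []-cong m≡n = Finₚ.toℕ-injective (trans (toℕ-[] _) (trans m≡n (sym (toℕ-[] _))))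

  [toℕ] : ∀ b → [ toℕ b ] ≡ b
  [toℕ] b = Finₚ.toℕ-injective (trans (toℕ-[] _) (m<n⇒m%n≡m (Finₚ.toℕ<n b)))

  %-absorbˡ : ∀ m k j → (m % N * k + j) % N ≡ (m * k + j) % N
  %-absorbˡ m k j = begin
    (m % N * k + j) % N                  ≡⟨ [m+kn]%n≡m%n (m % N * k + j) (m / N * k) N ⟨
    (m % N * k + j + m / N * k * N) % N  ≡⟨ cong (_% N) (rearrange (m % N) (m / N) k j N) ⟩
    ((m % N + m / N * N) * k + j) % N    ≡⟨ cong (λ m′ → (m′ * k + j) % N) (m≡m%n+[m/n]*n m N) ⟨
    (m * k + j) % N                      ∎
    where
    open ≡-Reasoning
    rearrange : ∀ a b k j n → a * k + j + b * k * n ≡ (a + b * n) * k + j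
    rearrange = solve-∀

  %-absorbʳ : ∀ i m → (i + m % N) % N ≡ (i + m) % N
  %-absorbʳ i m = begin
    (i + m % N) % N            ≡⟨ %-distribˡ-+ i (m % N) N ⟩
    (i % N + m % N % N) % N    ≡⟨ cong (λ m′ → (i % N + m′) % N) (m%n%n≡m%n m N) ⟩
    (i % N + m % N) % N        ≡⟨ %-distribˡ-+ i m N ⟨
    (i + m) % N                ∎
    where open ≡-Reasoning

  twist-squared : twist * twist ≡ 1 + (1 + 2 ^ (1 + t)) * N
  twist-squared = square (2 ^ (1 + t))
    where
    square : ∀ q → (1 + 2 * q) * (1 + 2 * q) ≡ 1 + (1 + q) * (2 * (2 * q))
    square = solve-∀

  twist-powers : ∀ (c e : Fin 2) →
    ∃[ k ] (twist ^ toℕ c * twist ^ toℕ e ≡ twist ^ toℕ ((toℕ c + toℕ e) mod 2) + k * N)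
  twist-powers zero zero = 0 , refl
  twist-powers zero (suc zero) = 0 , refl
  twist-powers (suc zero) zero = 0 , trans (*-identityʳ (twist * 1)) (sym (+-identityʳ (twist * 1)))
  twist-powers (suc zero) (suc zero) =
    1 + 2 ^ (1 + t) , trans (cong₂ _*_ (*-identityʳ twist) (*-identityʳ twist)) twist-squared

  infixl 7 _·_
  _·_ : Mcarrier r → Mcarrier r → Mcarrier r
  _·_ = Mmul r

  one : Mcarrier r
  one = Mone r

  0%N≡0 : 0 % N ≡ 0
  0%N≡0 = m<n⇒m%n≡m (>-nonZero⁻¹ N)

  [0]≡0 : toℕ [ 0 ] ≡ 0
  [0]≡0 = trans (toℕ-[] 0) 0%N≡0

  ·-assoc : ∀ x y z → (x · y) · z ≡ x · (y · z)
  ·-assoc (a , b) (c , d) (e , f) = cong₂ _,_ (fin2-assoc a c e) ([]-cong (begin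
    (toℕ [ B * twist ^ toℕ c + D ] * twist ^ toℕ e + F) % N
      ≡⟨ cong (λ m → (m * twist ^ toℕ e + F) % N) (toℕ-[] _) ⟩
    ((B * twist ^ toℕ c + D) % N * twist ^ toℕ e + F) % N
      ≡⟨ %-absorbˡ (B * twist ^ toℕ c + D) (twist ^ toℕ e) F ⟩
    ((B * twist ^ toℕ c + D) * twist ^ toℕ e + F) % N
      ≡⟨ cong (_% N) (expand B D F (twist ^ toℕ c) (twist ^ toℕ e)) ⟩
    (B * (twist ^ toℕ c * twist ^ toℕ e) + (D * twist ^ toℕ e + F)) % N
      ≡⟨ cong (λ m → (B * m + (D * twist ^ toℕ e + F)) % N) (proj₂ (twist-powers c e)) ⟩
    (B * (twist ^ toℕ c⊕e + k * N) + (D * twist ^ toℕ e + F)) % N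
      ≡⟨ cong (_% N) (collect B (twist ^ toℕ c⊕e) k N (D * twist ^ toℕ e + F)) ⟩
    (B * twist ^ toℕ c⊕e + (D * twist ^ toℕ e + F) + B * k * N) % N
      ≡⟨ [m+kn]%n≡m%n _ (B * k) N ⟩
    (B * twist ^ toℕ c⊕e + (D * twist ^ toℕ e + F)) % N
      ≡⟨ %-absorbʳ (B * twist ^ toℕ c⊕e) (D * twist ^ toℕ e + F) ⟨
    (B * twist ^ toℕ c⊕e + (D * twist ^ toℕ e + F) % N) % N
      ≡⟨ cong (λ m → (B * twist ^ toℕ c⊕e + m) % N) (toℕ-[] _) ⟨
    (B * twist ^ toℕ c⊕e + toℕ [ D * twist ^ toℕ e + F ]) % N ∎))
    where
    open ≡-Reasoning
    B = toℕ b
    D = toℕ d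
    F = toℕ f
    c⊕e = (toℕ c + toℕ e) mod 2
    k = proj₁ (twist-powers c e)
    fin2-assoc : ∀ (a c e : Fin 2) →
      (toℕ ((toℕ a + toℕ c) mod 2) + toℕ e) mod 2 ≡ (toℕ a + toℕ ((toℕ c + toℕ e) mod 2)) mod 2
    fin2-assoc = toWitness {a? = Finₚ.all? λ a → Finₚ.all? λ c → Finₚ.all? λ e → _ Fin.≟ _} _
    expand : ∀ b d f x y → (b * x + d) * y + f ≡ b * (x * y) + (d * y + f)
    expand = solve-∀
    collect : ∀ b x k n j → b * (x + k * n) + j ≡ b * x + j + b * k * n
    collect = solve-∀

  ·-identityˡ : ∀ x → one · x ≡ x
  ·-identityˡ (a , b) = cong₂ _,_ (fin2-identityˡ a)
    (trans ([]-cong (cong (λ m → (m * twist ^ toℕ a + toℕ b) % N) [0]≡0)) ([toℕ] b))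
    where
    fin2-identityˡ : ∀ (a : Fin 2) → (0 + toℕ a) mod 2 ≡ a
    fin2-identityˡ = toWitness {a? = Finₚ.all? λ a → _ Fin.≟ a} _

  ·-identityʳ : ∀ x → x · one ≡ x
  ·-identityʳ (a , b) = cong₂ _,_ (fin2-identityʳ a) (trans ([]-cong (cong (_% N) b·1+0≡b)) ([toℕ] b))
    where
    fin2-identityʳ : ∀ (a : Fin 2) → (toℕ a + 0) mod 2 ≡ a
    fin2-identityʳ = toWitness {a? = Finₚ.all? λ a → _ Fin.≟ a} _
    b·1+0≡b : toℕ b * 1 + toℕ [ 0 ] ≡ toℕ b
    b·1+0≡b = trans (cong₂ _+_ (*-identityʳ (toℕ b)) [0]≡0) (+-identityʳ (toℕ b))

  infix 8 _⁻¹
  _⁻¹ : Mcarrier r → Mcarrier r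
  (a , b) ⁻¹ = a , [ (N ∸ toℕ b) * twist ^ toℕ a ]

  fin2-self-inverse : ∀ (a : Fin 2) → (toℕ a + toℕ a) mod 2 ≡ zero
  fin2-self-inverse = toWitness {a? = Finₚ.all? λ a → _ Fin.≟ zero} _

  b+[N∸b]≡N : ∀ (b : Fin N) → toℕ b + (N ∸ toℕ b) ≡ N
  b+[N∸b]≡N b = m+[n∸m]≡n (<⇒≤ (Finₚ.toℕ<n b))

  ·-inverseʳ : ∀ x → x · x ⁻¹ ≡ one
  ·-inverseʳ (a , b) = cong₂ _,_ (fin2-self-inverse a) ([]-cong (begin
    (toℕ b * twist ^ toℕ a + toℕ [ (N ∸ toℕ b) * twist ^ toℕ a ]) % N
      ≡⟨ cong (λ m → (toℕ b * twist ^ toℕ a + m) % N) (toℕ-[] _) ⟩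
    (toℕ b * twist ^ toℕ a + (N ∸ toℕ b) * twist ^ toℕ a % N) % N
      ≡⟨ %-absorbʳ (toℕ b * twist ^ toℕ a) ((N ∸ toℕ b) * twist ^ toℕ a) ⟩
    (toℕ b * twist ^ toℕ a + (N ∸ toℕ b) * twist ^ toℕ a) % N
      ≡⟨ cong (_% N) (*-distribʳ-+ (twist ^ toℕ a) (toℕ b) (N ∸ toℕ b)) ⟨
    ((toℕ b + (N ∸ toℕ b)) * twist ^ toℕ a) % N
      ≡⟨ cong (λ m → (m * twist ^ toℕ a) % N) (b+[N∸b]≡N b) ⟩
    (N * twist ^ toℕ a) % N
      ≡⟨ cong (_% N) (*-comm N (twist ^ toℕ a)) ⟩
    (twist ^ toℕ a * N) % N
      ≡⟨ m*n%n≡0 (twist ^ toℕ a) N ⟩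
    0
      ≡⟨ 0%N≡0 ⟨
    0 % N ∎))
    where open ≡-Reasoning

  ·-inverseˡ : ∀ x → x ⁻¹ · x ≡ one
  ·-inverseˡ (a , b) = cong₂ _,_ (fin2-self-inverse a) ([]-cong (begin
    (toℕ [ (N ∸ toℕ b) * twist ^ toℕ a ] * twist ^ toℕ a + toℕ b) % N
      ≡⟨ cong (λ m → (m * twist ^ toℕ a + toℕ b) % N) (toℕ-[] _) ⟩
    ((N ∸ toℕ b) * twist ^ toℕ a % N * twist ^ toℕ a + toℕ b) % N
      ≡⟨ %-absorbˡ ((N ∸ toℕ b) * twist ^ toℕ a) (twist ^ toℕ a) (toℕ b) ⟩
    ((N ∸ toℕ b) * twist ^ toℕ a * twist ^ toℕ a + toℕ b) % N
      ≡⟨ cong (λ m → (m + toℕ b) % N)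
              (trans (*-assoc (N ∸ toℕ b) _ _) (cong ((N ∸ toℕ b) *_) (proj₂ (twist-powers a a)))) ⟩
    ((N ∸ toℕ b) * (twist ^ toℕ ((toℕ a + toℕ a) mod 2) + k * N) + toℕ b) % N
      ≡⟨ cong (λ c → ((N ∸ toℕ b) * (twist ^ toℕ c + k * N) + toℕ b) % N) (fin2-self-inverse a) ⟩
    ((N ∸ toℕ b) * (1 + k * N) + toℕ b) % N
      ≡⟨ cong (_% N) (collect (N ∸ toℕ b) k N (toℕ b)) ⟩
    (toℕ b + (N ∸ toℕ b) + (N ∸ toℕ b) * k * N) % N
      ≡⟨ [m+kn]%n≡m%n _ ((N ∸ toℕ b) * k) N ⟩
    (toℕ b + (N ∸ toℕ b)) % N
      ≡⟨ cong (_% N) (b+[N∸b]≡N b) ⟩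
    N % N
      ≡⟨ trans (n%n≡0 N) (sym 0%N≡0) ⟩
    0 % N ∎))
    where
    open ≡-Reasoning
    k = proj₁ (twist-powers a a)
    collect : ∀ x k n b → x * (1 + k * n) + b ≡ b + x + x * k * n
    collect = solve-∀

  M-group : FiniteGroup
  M-group = record
    { Carrier = Mcarrier r
    ; _∙_ = _·_
    ; ε = one
    ; _⁻¹ = _⁻¹
    ; isGroup = record
      { isMonoid = record
        { isSemigroup = record
          { isMagma = record { isEquivalence = isEquivalence ; ∙-cong = cong₂ _·_ }
          ; assoc = ·-assoc }
        ; identity = ·-identityˡ , ·-identityʳ }
      ; inverse = ·-inverseˡ , ·-inverseʳ
      ; ⁻¹-cong = cong _⁻¹ }
    ; size = 2 * N
    ; enumeration = ↔-sym Finₚ.*↔×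
    }

  τ : Mcarrier r → V
  τ (a , b) = bit a , parity (toℕ b)

  twist-power-odd : ∀ (c : Fin 2) → parity (twist ^ toℕ c) ≡ true
  twist-power-odd zero = refl
  twist-power-odd (suc zero) = trans (parity-* twist 1) (cong (λ p → not p ∧ true) (parity-* 2 (2 ^ (1 + t))))

  τ-hom : ∀ x y → τ (x · y) ≡ τ x ⊕ τ y
  τ-hom (a , b) (c , d) = cong₂ _,_ (bit-hom a c) (begin
    parity (toℕ [ B * twist ^ toℕ c + D ])   ≡⟨ cong parity (toℕ-[] _) ⟩
    parity ((B * twist ^ toℕ c + D) % N)     ≡⟨ parity-% _ N (parity-* 2 (2 ^ (r ∸ 2))) ⟩
    parity (B * twist ^ toℕ c + D)           ≡⟨ parity-+ (B * twist ^ toℕ c) D ⟩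
    parity (B * twist ^ toℕ c) xor parity D  ≡⟨ cong (_xor parity D) (parity-* B (twist ^ toℕ c)) ⟩
    (parity B ∧ parity (twist ^ toℕ c)) xor parity D
      ≡⟨ cong (λ p → (parity B ∧ p) xor parity D) (twist-power-odd c) ⟩
    (parity B ∧ true) xor parity D           ≡⟨ cong (_xor parity D) (∧-identityʳ (parity B)) ⟩
    parity B xor parity D                    ∎)
    where
    open ≡-Reasoning
    B = toℕ b
    D = toℕ d
    bit-hom : ∀ (a c : Fin 2) → bit ((toℕ a + toℕ c) mod 2) ≡ bit a xor bit c
    bit-hom = toWitness {a? = Finₚ.all? λ a → Finₚ.all? λ c →
      bit ((toℕ a + toℕ c) mod 2) Bool.≟ bit a xor bit c} _

  [1]≡1 : toℕ [ 1 ] ≡ 1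
  [1]≡1 = trans (toℕ-[] 1) (m<n⇒m%n≡m (*-monoʳ-≤ 2 (m^n>0 2 (r ∸ 2))))

  τ-surjective : ∀ v → ∃[ h ] τ h ≡ v
  τ-surjective (false , false) = (zero , [ 0 ]) , cong (λ n → false , parity n) [0]≡0
  τ-surjective (false , true) = (zero , [ 1 ]) , cong (λ n → false , parity n) [1]≡1
  τ-surjective (true , false) = (suc zero , [ 0 ]) , cong (λ n → true , parity n) [0]≡0
  τ-surjective (true , true) = (suc zero , [ 1 ]) , cong (λ n → true , parity n) [1]≡1

  open FiniteGroupTheory M-group using (∣_∣)
  open KleinQuotient M-group τ τ-hom using (kernel; size≡4∣kernel∣; davenport-bound)

  ∣kernel∣≡ : ∣ kernel ∣ ≡ 2 ^ (r ∸ 2)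
  ∣kernel∣≡ = *-cancelˡ-≡ ∣ kernel ∣ (2 ^ (r ∸ 2)) 4 (begin
    4 * ∣ kernel ∣                                          ≡⟨ quadruple ∣ kernel ∣ ⟩
    (∣ kernel ∣ + ∣ kernel ∣) + (∣ kernel ∣ + ∣ kernel ∣)   ≡⟨ size≡4∣kernel∣ τ-surjective ⟨
    2 * (2 * 2 ^ (r ∸ 2))                                   ≡⟨ double-double (2 ^ (r ∸ 2)) ⟩
    4 * 2 ^ (r ∸ 2)                                         ∎)
    where
    open ≡-Reasoning
    quadruple : ∀ k → 4 * k ≡ (k + k) + (k + k)
    quadruple = solve-∀
    double-double : ∀ p → 2 * (2 * p) ≡ 4 * p
    double-double = solve-∀

  upper-bound : DProp (M r) (N + 1)
  upper-bound = davenport-bound N+1≡ (≤-reflexive ∣kernel∣≡)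
    where
    N+1≡ : N + 1 ≡ suc (2 ^ (r ∸ 2) + 2 ^ (r ∸ 2))
    N+1≡ = trans (+-comm N 1) (cong (λ n → suc (2 ^ (r ∸ 2) + n)) (+-identityʳ (2 ^ (r ∸ 2))))

  open FiniteGroup M-group using (monoid)
  open RawMonoidDefinitions (M r) using () renaming (_×_ to power)
  open MonoidSum monoid using (sum-cong-≗; sum-replicate)
  module XorSum =
    Algebra.Properties.CommutativeMonoid.Sum (CommutativeRing.+-commutativeMonoid xor-∧-commutativeRing)

  x y : Mcarrier r
  x = suc zero , [ 0 ]
  y = zero , [ 1 ]

  y-power : ∀ n → power n y ≡ (zero , [ n ])
  y-power zero = refl
  y-power (suc n) = trans (cong (y ·_) (y-power n)) (cong (zero ,_) ([]-cong (begin
    (toℕ [ 1 ] * 1 + toℕ [ n ]) % N  ≡⟨ cong₂ (λ a b → (a * 1 + b) % N) [1]≡1 (toℕ-[] n) ⟩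
    (1 + n % N) % N                  ≡⟨ %-absorbʳ 1 n ⟩
    suc n % N                        ∎)))
    where open ≡-Reasoning

  x-bit : Mcarrier r → Bool
  x-bit = proj₁ ∘ τ

  x-bit-prod : ∀ {n} (h : Fin n → Mcarrier r) → x-bit (prod (M r) h) ≡ XorSum.sum (x-bit ∘ h)
  x-bit-prod {zero} h = refl
  x-bit-prod {suc n} h = trans (cong proj₁ (τ-hom (h zero) (prod (M r) (h ∘ suc))))
                               (cong (x-bit (h zero) xor_) (x-bit-prod (h ∘ suc)))

  x-then-ys : ∀ k → Fin (suc k) → Mcarrier r
  x-then-ys k zero = x
  x-then-ys k (suc _) = y

  x-then-ys-y : ∀ {k} (j : Fin (suc k)) → j ≢ zero → x-then-ys k j ≡ y
  x-then-ys-y zero j≢0 = ⊥-elim (j≢0 refl)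
  x-then-ys-y (suc _) _ = refl

  module Subsequence {m k : ℕ} {i : Fin (suc m) → Fin (suc k)} (increasing : StrictlyIncreasing (M r) i)
                     (σ : Permutation′ (suc m)) where

    Π : Mcarrier r
    Π = prod (M r) (λ j → x-then-ys k (i (σ ⟨$⟩ʳ j)))

    increasing-injective : ∀ {a b} → i a ≡ i b → a ≡ b
    increasing-injective {a} {b} ia≡ib with Finₚ.<-cmp a b
    ... | tri< a<b _ _ = ⊥-elim (<-irrefl (cong toℕ ia≡ib) (increasing a b a<b))
    ... | tri≈ _ a≡b _ = a≡b
    ... | tri> _ _ b<a = ⊥-elim (<-irrefl (cong toℕ (sym ia≡ib)) (increasing b a b<a))

    later-nonzero : ∀ j → i (suc j) ≢ zero
    later-nonzero j ij≡0 = n≮0 (subst (λ l → toℕ (i zero) < toℕ l) ij≡0 (increasing zero (suc j) z<s))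

    x-bit-Π : i zero ≡ zero → x-bit Π ≡ true
    x-bit-Π i₀≡0 = begin
      x-bit Π                          ≡⟨ x-bit-prod (λ j → x-then-ys k (i (σ ⟨$⟩ʳ j))) ⟩
      XorSum.sum (f ∘ (σ ⟨$⟩ʳ_))       ≡⟨ XorSum.sum-permute f σ ⟨
      f zero xor XorSum.sum (f ∘ suc)  ≡⟨ cong₂ _xor_ (cong (x-bit ∘ x-then-ys k) i₀≡0) ys-even ⟩
      true                             ∎
      where
      open ≡-Reasoning
      f : Fin (suc m) → Bool
      f = x-bit ∘ x-then-ys k ∘ i
      ys-even : XorSum.sum (f ∘ suc) ≡ false
      ys-even = trans (XorSum.sum-cong-≗ λ j → cong x-bit (x-then-ys-y (i (suc j)) (later-nonzero j)))
                      (XorSum.sum-replicate-zero m)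

    module _ (i₀≢0 : i zero ≢ zero) where

      nonzero : ∀ j → i j ≢ zero
      nonzero zero = i₀≢0
      nonzero (suc j) = later-nonzero j

      Π≡y-power : Π ≡ power (suc m) y
      Π≡y-power = trans (sum-cong-≗ λ j → x-then-ys-y _ (nonzero (σ ⟨$⟩ʳ j))) (sum-replicate (suc m))

      length<k : suc m ≤ k
      length<k = Finₚ.injective⇒≤ {f = λ j → Fin.punchOut (nonzero j ∘ sym)} λ {a} {b} eq →
        increasing-injective (Finₚ.punchOut-injective (nonzero a ∘ sym) (nonzero b ∘ sym) eq)

  no-zero-subsequence : ∀ k → k < N → ¬ D'Prop (M r) (suc k)
  no-zero-subsequence k k<N D′ with D′ (x-then-ys k)
  ... | m , i , σ , increasing , Π≡1 with i zero Fin.≟ zero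
  ... | yes i₀≡0 = contradiction (trans (sym (x-bit-Π i₀≡0)) (cong x-bit Π≡1)) λ ()
    where open Subsequence increasing σ
  ... | no i₀≢0 = contradiction (begin
    suc m          ≡⟨ m<n⇒m%n≡m (≤-<-trans (length<k i₀≢0) k<N) ⟨
    suc m % N      ≡⟨ toℕ-[] (suc m) ⟨
    toℕ [ suc m ]  ≡⟨ cong (toℕ ∘ proj₂) (trans (sym (y-power (suc m))) (trans (sym (Π≡y-power i₀≢0)) Π≡1)) ⟩
    toℕ [ 0 ]      ≡⟨ [0]≡0 ⟩
    0              ∎) λ ()
    where
    open Subsequence increasing σ
    open ≡-Reasoning

  no-smaller : ∀ k → 1 ≤ k → k < N + 1 → ¬ D'Prop (M r) k
  no-smaller (suc k) _ k<N+1 = no-zero-subsequence k (s≤s⁻¹ (subst (suc (suc k) ≤_) (+-comm N 1) k<N+1))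

corollary4p2 : (r : ℕ) → 4 ≤ r →
    StrongDavenportIs (M r) (2 ^ (r ∸ 1) + 1) × DavenportIs (M r) (2 ^ (r ∸ 1) + 1)
corollary4p2 (suc (suc (suc (suc t)))) (s≤s (s≤s (s≤s (s≤s _)))) =
  least-positive 1≤N+1 (D⇒D′ (M r) upper-bound) no-smaller ,
  least-positive 1≤N+1 upper-bound (λ k 1≤k k<N+1 → no-smaller k 1≤k k<N+1 ∘ D⇒D′ (M r))
  where
  open Modular t
  1≤N+1 : 1 ≤ N + 1
  1≤N+1 = m≤n+m 1 N
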